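{- Let $(G,H_i)_{i=1}^{q+2}$ and $(G',H'_i)_{i=1}^{q+2}$ be group packets in $(q+2)\text{ -GP}(n)$ with common pairwise intersections $K$ and $K'$ respectively, and let $\alpha\colon (G,H_i)\to (G',H'_i)$ be an admissible morphism. Then the maps $\bar\alpha\colon G/K\to G'/K'$, $gK\mapsto\alpha(g)K'$, and $\bar\alpha_i\colon G/H_i\to G'/H'_i$, $gH_i\mapsto \alpha(g)H'_i$, are well defined and form an isotopy between the orthogonal arrays $G/K\subset\prod_i G/H_i$ and $G'/K'\subset \prod_i G'/H'_i$. Moreover, let $A=\mathrm{Aut}(G/K,G/H_i)$ and $A'=\mathrm{Aut}(G'/K',G'/H'_i)$, let $f\colon G\to A$ and $f'\colon G'\to A'$ send an element to the tuple of left multiplications by it, and let $\alpha_*\colon A\to A'$, $(\sigma_i)\mapsto(\bar\alpha_i\sigma_i\bar\alpha_i^{ -1})$. Then $\alpha_*$ is a group isomorphism, $\alpha_*\circ f=f'\circ\alpha$, and $f$, $f'$, $\alpha_*$ are admissible morphisms of group packets $(G,H_i)\to(A,A_i)$, $(G',H'_i)\to(A',A'_i)$, $(A,A_i)\to(A',A'_i)$, where $A_i=\mathrm{Stab}_A(H_i)$ is the stabilizer in $A$ of the coset $H_i\in G/H_i$ and $A'_i=\mathrm{Stab}_{A'}(H'_i)$.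
   Context: A group packet in $(q+2)\text{ -GP}(n)$ is the data $(G,H_i)_{i=1}^{q+2}$ of a group $G$ and subgroups $H_i\le G$ such that there is a subgroup $K$ with $H_i\cap H_j=K$ for all $i\neq j$ and $[G:H_i]=[H_i:K]=n$. To it is associated the orthogonal array $S=G/K$, $X_i=G/H_i$, $\pi_i(gK)=gH_i$. An admissible morphism $\alpha\colon(G,H_i)\to(G',H'_i)$ is a group homomorphism $\alpha\colon G\to G'$ with $\alpha(H_i)\subset H'_i$ for all $i$ such that each induced map $G/H_i\to G'/H'_i$, $gH_i\mapsto\alpha(g)H'_i$, is a bijection. An orthogonal array $(S,X_i,\pi_i)_{i=1}^{q+2}$ consists of sets $S$, $X_i$ with $|X_i|=n$ and maps $\pi_i\colon S\to X_i$ such that $\pi_i\times\pi_j\colon S\to X_i\times X_j$ is a bijection for all $i\ne j$. An isotopy $(S,X_i,\pi_i)\to(S',X'_i,\pi'_i)$ is a collection of bijections $\sigma\colon S\to S'$, $\sigma_i\colon X_i\to X'_i$ with $\pi'_i\sigma=\sigma_i\pi_i$ for all $i$. Regarding $S\subset\prod_iX_i$ via $\prod_i\pi_i$, the autotopy group is $\mathrm{Aut}(S,X_i)=\{(\sigma_i)\in\prod_i\mathrm{Sym}(X_i):(\sigma_i)(S)=S\}$. -}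

module Defs where

open import Level using (Level; _⊔_) renaming (suc to lsuc)
open import Algebra.Bundles using (Group)
open import Algebra.Structures using (IsGroup)
open import Algebra.Morphism.Structures using (module GroupMorphisms)
open import Data.Fin using (Fin)
open import Data.Nat using (ℕ; _+_)
open import Data.Product using (Σ; ∃; _×_; _,_; proj₁; proj₂)
open import Relation.Binary.Bundles using (Setoid)
open import Relation.Binary.PropositionalEquality using (_≡_)
import Relation.Binary.PropositionalEquality as ≡
open import Relation.Nullary using (¬_)
open import Function.Bundles using (Inverse)
open import Function.Definitions using (Congruent; Bijective)
open import Relation.Unary using (Pred)
import Algebra.Properties.Group as GProps
import Relation.Binary.Reasoning.Setoid as SetoidReasoning
import Function.Consequences.Setoid as FCS

private
  variable
    c ℓ c' ℓ' p p' : Level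

record Subgroup (G : Group c ℓ) (p : Level) : Set (c ⊔ ℓ ⊔ lsuc p) where
  open Group G
  field
    mem : Pred Carrier p
    resp : ∀ {x y} → x ≈ y → mem x → mem y
    ε∈ : mem ε
    ∙∈ : ∀ {x y} → mem x → mem y → mem (x ∙ y)
    ⁻¹∈ : ∀ {x} → mem x → mem (x ⁻¹)
open Subgroup public

module GroupLemmas (G : Group c ℓ) where
  open Group G
  open GProps G
  open SetoidReasoning setoid

  cancelˡ : ∀ y z → y ⁻¹ ∙ (y ∙ z) ≈ z
  cancelˡ y z = begin
    y ⁻¹ ∙ (y ∙ z) ≈⟨ sym (assoc _ _ _) ⟩
    (y ⁻¹ ∙ y) ∙ z ≈⟨ ∙-congʳ (inverseˡ y) ⟩
    ε ∙ z          ≈⟨ identityˡ z ⟩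
    z              ∎

  cancelʳ : ∀ y z → y ∙ (y ⁻¹ ∙ z) ≈ z
  cancelʳ y z = begin
    y ∙ (y ⁻¹ ∙ z) ≈⟨ sym (assoc _ _ _) ⟩
    (y ∙ y ⁻¹) ∙ z ≈⟨ ∙-congʳ (inverseʳ y) ⟩
    ε ∙ z          ≈⟨ identityˡ z ⟩
    z              ∎

  mulinv : ∀ g x y → (g ∙ x) ⁻¹ ∙ (g ∙ y) ≈ x ⁻¹ ∙ y
  mulinv g x y = begin
    (g ∙ x) ⁻¹ ∙ (g ∙ y)       ≈⟨ ∙-congʳ (⁻¹-anti-homo-∙ g x) ⟩
    (x ⁻¹ ∙ g ⁻¹) ∙ (g ∙ y)    ≈⟨ assoc _ _ _ ⟩
    x ⁻¹ ∙ (g ⁻¹ ∙ (g ∙ y))    ≈⟨ ∙-congˡ (cancelˡ g y) ⟩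
    x ⁻¹ ∙ y                   ∎

-- Left cosets G/H as a setoid on the carrier of G:
--   x ~ y  iff  x⁻¹ y ∈ H   (i.e. xH = yH).

module _ {G : Group c ℓ} (H : Subgroup G p) where
  open Group G
  open GProps G
  open GroupLemmas G

  CosetRel : Carrier → Carrier → Set p
  CosetRel x y = mem H (x ⁻¹ ∙ y)

  ≈⇒coset : ∀ {x y} → x ≈ y → CosetRel x y
  ≈⇒coset {x} eq = resp H (trans (sym (inverseˡ x)) (∙-congˡ eq)) (ε∈ H)

  coset-refl : ∀ {x} → CosetRel x x
  coset-refl = ≈⇒coset refl

  coset-sym : ∀ {x y} → CosetRel x y → CosetRel y x
  coset-sym {x} {y} m =
    resp H (trans (⁻¹-anti-homo-∙ _ _) (∙-congˡ (⁻¹-involutive x))) (⁻¹∈ H m)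

  coset-trans : ∀ {x y z} → CosetRel x y → CosetRel y z → CosetRel x z
  coset-trans {x} {y} {z} m₁ m₂ =
    resp H (trans (assoc _ _ _) (∙-congˡ (cancelʳ y z))) (∙∈ H m₁ m₂)

  Coset : Setoid c p
  Coset = record
    { Carrier = Carrier
    ; _≈_ = CosetRel
    ; isEquivalence = record
      { refl = coset-refl ; sym = coset-sym ; trans = coset-trans } }

module _ {G : Group c ℓ} (H : Subgroup G p) (K : Subgroup G p) where
  open Group G

  SubCoset : Setoid (c ⊔ p) p
  SubCoset = record
    { Carrier = Σ Carrier (mem H)
    ; _≈_ = λ x y → CosetRel K (proj₁ x) (proj₁ y)
    ; isEquivalence = record
      { refl = coset-refl K ; sym = coset-sym K ; trans = coset-trans K } }

HasSize : ∀ {a b} → Setoid a b → ℕ → Set (a ⊔ b)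
HasSize S n = Inverse S (≡.setoid (Fin n))

record IsGroupPacket (q n : ℕ) (G : Group c ℓ)
         (H : Fin (q + 2) → Subgroup G p) (K : Subgroup G p)
         : Set (c ⊔ ℓ ⊔ p) where
  field
    intersection : ∀ i j → ¬ (i ≡ j) → ∀ x →
      (mem (H i) x × mem (H j) x → mem K x) ×
      (mem K x → mem (H i) x × mem (H j) x)
    index-G-H : ∀ i → HasSize (Coset (H i)) n
    index-H-K : ∀ i → HasSize (SubCoset (H i) K) n

record IsAdmissible {k : ℕ} (G : Group c ℓ) (G' : Group c' ℓ')
         (H : Fin k → Subgroup G p) (H' : Fin k → Subgroup G' p')
         (α : Group.Carrier G → Group.Carrier G')
         : Set (c ⊔ ℓ ⊔ c' ⊔ ℓ' ⊔ p ⊔ p') where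
  field
    homomorphism : GroupMorphisms.IsGroupHomomorphism
                     (Group.rawGroup G) (Group.rawGroup G') α
    maps-into : ∀ i {x} → mem (H i) x → mem (H' i) (α x)
    induced-bijective : ∀ i → Bijective (CosetRel (H i)) (CosetRel (H' i)) α

-- Isotopies between (the data of) orthogonal arrays (S, X_i, π_i),
-- with S, X_i setoids; the maps σ, σ_i are given on representatives
-- and are required to be well defined (congruent) and bijective.

record IsIsotopy {k : ℕ} {a b a₁ b₁ a' b' a₁' b₁' : Level}
         (S : Setoid a b) (X : Fin k → Setoid a₁ b₁)
         (π : ∀ i → Setoid.Carrier S → Setoid.Carrier (X i))
         (S' : Setoid a' b') (X' : Fin k → Setoid a₁' b₁')
         (π' : ∀ i → Setoid.Carrier S' → Setoid.Carrier (X' i))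
         (σ : Setoid.Carrier S → Setoid.Carrier S')
         (σᵢ : ∀ i → Setoid.Carrier (X i) → Setoid.Carrier (X' i))
         : Set (a ⊔ b ⊔ a₁ ⊔ b₁ ⊔ b' ⊔ a₁' ⊔ b₁' ⊔ a') where
  field
    σ-cong : Congruent (Setoid._≈_ S) (Setoid._≈_ S') σ
    σ-bijective : Bijective (Setoid._≈_ S) (Setoid._≈_ S') σ
    σᵢ-cong : ∀ i → Congruent (Setoid._≈_ (X i)) (Setoid._≈_ (X' i)) (σᵢ i)
    σᵢ-bijective : ∀ i → Bijective (Setoid._≈_ (X i)) (Setoid._≈_ (X' i)) (σᵢ i)
    commutes : ∀ i s → Setoid._≈_ (X' i) (π' i (σ s)) (σᵢ i (π i s))

-- The autotopy group Aut(S, X_i) = {(σ_i) ∈ ∏ Sym(X_i) : (σ_i)(S) = S}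
-- where S is regarded as the subset {(π_i s)_i} of ∏ X_i.

module Autotopy {k : ℕ} {a b a₁ b₁ : Level}
         (S : Setoid a b) (X : Fin k → Setoid a₁ b₁)
         (π : ∀ i → Setoid.Carrier S → Setoid.Carrier (X i)) where

  open Inverse
  module X (i : Fin k) = Setoid (X i)

  Tuple : Set (a₁ ⊔ b₁)
  Tuple = (i : Fin k) → Inverse (X i) (X i)

  PreservesS : Tuple → Set (a ⊔ b₁)
  PreservesS σ =
    (∀ s → ∃ λ s' → ∀ i → X._≈_ i (to (σ i) (π i s)) (π i s')) ×
    (∀ s' → ∃ λ s → ∀ i → X._≈_ i (to (σ i) (π i s)) (π i s'))

  Elt : Set (a ⊔ a₁ ⊔ b₁)
  Elt = Σ Tuple PreservesS

  _≈A_ : Elt → Elt → Set (a₁ ⊔ b₁)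
  σ ≈A τ = ∀ i x → X._≈_ i (to (proj₁ σ i) x) (to (proj₁ τ i) x)

  comp : ∀ {i} → Inverse (X i) (X i) → Inverse (X i) (X i) → Inverse (X i) (X i)
  comp {i} f g = record
    { to = λ x → to f (to g x)
    ; from = λ x → from g (from f x)
    ; to-cong = λ e → to-cong f (to-cong g e)
    ; from-cong = λ e → from-cong g (from-cong f e)
    ; inverse = (λ e → inverseˡ f (inverseˡ g e)) , (λ e → inverseʳ g (inverseʳ f e)) }

  idᵢ : ∀ {i} → Inverse (X i) (X i)
  idᵢ {i} = record
    { to = λ x → x ; from = λ x → x ; to-cong = λ e → e ; from-cong = λ e → e
    ; inverse = (λ e → e) , (λ e → e) }

  invᵢ : ∀ {i} → Inverse (X i) (X i) → Inverse (X i) (X i)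
  invᵢ f = record
    { to = from f ; from = to f ; to-cong = from-cong f ; from-cong = to-cong f
    ; inverse = inverseʳ f , inverseˡ f }

  _∙A_ : Elt → Elt → Elt
  (σ , σ₁ , σ₂) ∙A (τ , τ₁ , τ₂) =
    (λ i → comp (σ i) (τ i)) ,
    (λ s → let (s₁ , e₁) = τ₁ s ; (s₂ , e₂) = σ₁ s₁ in
           s₂ , λ i → X.trans i (to-cong (σ i) (e₁ i)) (e₂ i)) ,
    (λ s' → let (s₁ , e₁) = σ₂ s' ; (s₀ , e₀) = τ₂ s₁ in
           s₀ , λ i → X.trans i (to-cong (σ i) (e₀ i)) (e₁ i))

  εA : Elt
  εA = (λ i → idᵢ) , (λ s → s , λ i → X.refl i) , (λ s → s , λ i → X.refl i)

  _⁻¹A : Elt → Elt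
  (σ , σ₁ , σ₂) ⁻¹A =
    (λ i → invᵢ (σ i)) ,
    (λ s → let (t , e) = σ₂ s in t , λ i → inverseʳ (σ i) (X.sym i (e i))) ,
    (λ s' → let (t , e) = σ₁ s' in t , λ i → inverseʳ (σ i) (X.sym i (e i)))

  isGroup : IsGroup _≈A_ _∙A_ εA _⁻¹A
  isGroup = record
    { isMonoid = record
      { isSemigroup = record
        { isMagma = record
          { isEquivalence = record
            { refl = λ i x → X.refl i
            ; sym = λ e i x → X.sym i (e i x)
            ; trans = λ e f i x → X.trans i (e i x) (f i x) }
          ; ∙-cong = λ {σ} {σ'} {τ} {τ'} e f i x →
              X.trans i (to-cong (proj₁ σ i) (f i x)) (e i (to (proj₁ τ' i) x)) }
        ; assoc = λ _ _ _ i x → X.refl i }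
      ; identity = (λ _ i x → X.refl i) , (λ _ i x → X.refl i) }
    ; inverse = (λ σ i x → strictlyInverseʳ (proj₁ σ i) x)
              , (λ σ i x → strictlyInverseˡ (proj₁ σ i) x)
    ; ⁻¹-cong = λ {σ} {τ} e i x →
        X.sym i (inverseʳ (proj₁ τ i)
          (X.trans i (X.sym i (strictlyInverseˡ (proj₁ σ i) x))
                     (e i (from (proj₁ σ i) x)))) }

  group : Group (a ⊔ a₁ ⊔ b₁) (a₁ ⊔ b₁)
  group = record { isGroup = isGroup }

  Stab : ∀ i → Setoid.Carrier (X i) → Subgroup group b₁
  Stab i x = record
    { mem = λ σ → X._≈_ i (to (proj₁ σ i) x) x
    ; resp = λ e m → X.trans i (X.sym i (e i x)) m
    ; ε∈ = X.refl i
    ; ∙∈ = λ {σ} {τ} mσ mτ → X.trans i (to-cong (proj₁ σ i) mτ) mσ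
    ; ⁻¹∈ = λ {σ} mσ → inverseʳ (proj₁ σ i) (X.sym i mσ) }

module Packet {q : ℕ} (G : Group c ℓ)
         (H : Fin (q + 2) → Subgroup G p) (K : Subgroup G p) where
  open Group G
  open GroupLemmas G

  -- π_i : G/K → G/H_i,  gK ↦ gH_i  (identity on representatives)
  proj : Fin (q + 2) → Carrier → Carrier
  proj i x = x

  module Aut = Autotopy {k = q + 2} (Coset K) (λ i → Coset (H i)) proj

  AutGroup : Group (c ⊔ p) (c ⊔ p)
  AutGroup = Aut.group

  -- A_i = Stab_A(H_i), the stabiliser of the coset H_i = εH_i ∈ G/H_i
  AutStab : Fin (q + 2) → Subgroup AutGroup p
  AutStab i = Aut.Stab i ε

  leftMulᵢ : Carrier → ∀ i → Inverse (Coset (H i)) (Coset (H i))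
  leftMulᵢ g i = record
    { to = g ∙_
    ; from = g ⁻¹ ∙_
    ; to-cong = cg g
    ; from-cong = cg (g ⁻¹)
    ; inverse =
        FCS.strictlyInverseˡ⇒inverseˡ (Coset (H i)) (Coset (H i)) (cg g)
          (λ y → ≈⇒coset (H i) (cancelʳ g y)) ,
        FCS.strictlyInverseʳ⇒inverseʳ (Coset (H i)) (Coset (H i)) (cg (g ⁻¹))
          (λ y → ≈⇒coset (H i) (cancelˡ g y)) }
    where
    cg : ∀ h {x y} → CosetRel (H i) x y → CosetRel (H i) (h ∙ x) (h ∙ y)
    cg h {x} {y} m = resp (H i) (sym (mulinv h x y)) m

  leftMul : Carrier → Group.Carrier AutGroup
  leftMul g =
    leftMulᵢ g ,
    (λ s → g ∙ s , λ i → coset-refl (H i)) ,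
    (λ s' → g ⁻¹ ∙ s' , λ i → ≈⇒coset (H i) (cancelʳ g s'))

{-# OPTIONS --safe #-}
module Submission where

-- For i ≠ j the inclusion H_i/K → G/H_j is injective (H_i ∩ H_j = K), hence bijective
-- since both sides have n elements; so G/K → G/H_i × G/H_j is onto, and α, bijective on
-- two of the G/H_i, is bijective on G/K: it is an isotopy. Conjugation by any isotopy
-- is an isomorphism of autotopy groups carrying Stab(x) into Stab(σᵢ x). Sending
-- σ ↦ σᵢ(H_i) identifies A/A_i with G/H_i and A_i/⋂ⱼA_j with H_i/K, so (A, A_i) is again
-- a packet; α_* is admissible because α_* ∘ f = f' ∘ α relates the coset bijections.

open import Defs
open import Level using (Level)
open import Algebra.Bundles using (Group)
open import Algebra.Morphism.Structures using (module GroupMorphisms)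
open import Data.Fin using (Fin; zero; suc; punchOut; _↑ʳ_; _≟_)
open import Data.Fin.Properties using (any?; punchOut-injective; injective⇒≤; ↑ʳ-injective)
open import Data.Nat using (ℕ; _+_)
open import Data.Nat.Properties using (1+n≰n)
open import Data.Product using (Σ; _×_; proj₁; proj₂; _,_; ∃)
open import Function.Bundles using (Inverse; Bijection; Surjection)
open import Function.Definitions using (Congruent; Injective; Surjective; Bijective)
open import Function.Properties.Bijection using (Bijection⇒Inverse)
open import Function.Properties.Inverse using (Inverse⇒Bijection)
open import Relation.Binary.Bundles using (Setoid)
open import Relation.Binary.PropositionalEquality as ≡ using (_≡_; _≢_)
open import Relation.Nullary using (yes; no; contradiction)
import Algebra.Properties.Group as GroupProperties
import Function.Construct.Composition as Composition
import Function.Construct.Symmetry as Symmetry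
import Relation.Binary.Reasoning.Setoid as SetoidReasoning

Fin-injective⇒surjective : ∀ {n} (f : Fin n → Fin n) → Injective _≡_ _≡_ f →
                           ∀ y → ∃ λ x → f x ≡ y
Fin-injective⇒surjective {ℕ.zero}  f f-inj ()
Fin-injective⇒surjective {ℕ.suc m} f f-inj y with any? (λ x → f x ≟ y)
... | yes hit  = hit
... | no  miss = contradiction (injective⇒≤ punchOut-y∘f-injective) 1+n≰n
  where
  y≢f : ∀ x → y ≢ f x
  y≢f x y≡fx = miss (x , ≡.sym y≡fx)

  punchOut-y∘f : Fin (ℕ.suc m) → Fin m
  punchOut-y∘f x = punchOut (y≢f x)

  punchOut-y∘f-injective : Injective _≡_ _≡_ punchOut-y∘f
  punchOut-y∘f-injective eq = f-inj (punchOut-injective (y≢f _) (y≢f _) eq)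

module _ {a b a' b'} {S : Setoid a b} {T : Setoid a' b'} {n : ℕ} where
  private
    module S = Setoid S
    module T = Setoid T

  HasSize-injective⇒surjective : HasSize S n → HasSize T n →
    (h : S.Carrier → T.Carrier) → Congruent S._≈_ T._≈_ h → Injective S._≈_ T._≈_ h →
    Surjective S._≈_ T._≈_ h
  HasSize-injective⇒surjective φ ψ h h-cong h-inj t =
    let (i , hᵢ≡t) = Fin-injective⇒surjective h-on-Fin h-on-Fin-injective (ψ.to t)
    in φ.from i , λ z≈ → T.trans (h-cong z≈) (ψ-injective hᵢ≡t)
    where
    module φ = Inverse φ
    module ψ = Inverse ψ

    ψ-injective : Injective T._≈_ _≡_ ψ.to
    ψ-injective = Bijection.injective (Inverse⇒Bijection ψ)

    φ⁻¹-injective : Injective _≡_ S._≈_ φ.from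
    φ⁻¹-injective = Bijection.injective (Inverse⇒Bijection (Symmetry.inverse φ))

    h-on-Fin : Fin n → Fin n
    h-on-Fin i = ψ.to (h (φ.from i))

    h-on-Fin-injective : Injective _≡_ _≡_ h-on-Fin
    h-on-Fin-injective eq = φ⁻¹-injective (h-inj (ψ-injective eq))

HasSize-resp-bijection : ∀ {a b a' b'} {S : Setoid a b} {T : Setoid a' b'} {n} →
                         Bijection S T → HasSize S n → HasSize T n
HasSize-resp-bijection S⤖T = Composition.inverse (Symmetry.inverse (Bijection⇒Inverse S⤖T))

module CosetProperties {c ℓ p} {G : Group c ℓ} (H : Subgroup G p) where
  open Group G
  open GroupProperties G using (ε⁻¹≈ε)
  open GroupLemmas G using (mulinv)

  coset-respʳ : ∀ {x y y'} → y ≈ y' → CosetRel H x y → CosetRel H x y'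
  coset-respʳ y≈y' x~y = coset-trans H x~y (≈⇒coset H y≈y')

  coset-∙ˡ : ∀ g {x y} → CosetRel H x y → CosetRel H (g ∙ x) (g ∙ y)
  coset-∙ˡ g {x} {y} = resp H (sym (mulinv g x y))

  ∙ˡ-coset : ∀ g {x y} → CosetRel H (g ∙ x) (g ∙ y) → CosetRel H x y
  ∙ˡ-coset g {x} {y} = resp H (mulinv g x y)

  mem⇒coset-ε : ∀ {x} → mem H x → CosetRel H x ε
  mem⇒coset-ε x∈H = resp H (sym (identityʳ _)) (⁻¹∈ H x∈H)

  coset-ε⇒mem : ∀ {x} → CosetRel H ε x → mem H x
  coset-ε⇒mem {x} = resp H (trans (∙-congʳ ε⁻¹≈ε) (identityˡ x))

  coset⇒translate-ε : ∀ {g y} → CosetRel H y g → CosetRel H (g ⁻¹ ∙ y) ε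
  coset⇒translate-ε {g} y~g = coset-respʳ (inverseˡ g) (coset-∙ˡ (g ⁻¹) y~g)

  translate-ε⇒coset : ∀ {g y} → CosetRel H (g ⁻¹ ∙ y) ε → CosetRel H y g
  translate-ε⇒coset {g} m = ∙ˡ-coset (g ⁻¹) (coset-respʳ (sym (inverseˡ g)) m)

homomorphism⇒coset-cong :
  ∀ {c ℓ c' ℓ' p p'} {G : Group c ℓ} {G' : Group c' ℓ'} {α : Group.Carrier G → Group.Carrier G'} →
  GroupMorphisms.IsGroupHomomorphism (Group.rawGroup G) (Group.rawGroup G') α →
  (H : Subgroup G p) (H' : Subgroup G' p') → (∀ {x} → mem H x → mem H' (α x)) →
  Congruent (CosetRel H) (CosetRel H') α
homomorphism⇒coset-cong {G = G} {G'} hom H H' maps-into {x} {y} x~y =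
  resp H' (G'.trans (homo (x G.⁻¹) y) (G'.∙-congʳ (⁻¹-homo x))) (maps-into x~y)
  where
  module G = Group G
  module G' = Group G'
  open GroupMorphisms.IsGroupHomomorphism hom

module _ {a b a' b' a₂ b₂ a₃ b₃} {X : Setoid a b} {Y : Setoid a' b'}
         {X' : Setoid a₂ b₂} {Y' : Setoid a₃ b₃} where
  private
    module Y = Setoid Y
    module Y' = Setoid Y'

  commuting-square⇒bijective :
    (f : Surjection X Y) (f' : Bijection X' Y') (g : Bijection X X')
    (β : Y.Carrier → Y'.Carrier) → Congruent Y._≈_ Y'._≈_ β →
    (∀ x → β (Surjection.to f x) Y'.≈ Bijection.to f' (Bijection.to g x)) →
    Bijective Y._≈_ Y'._≈_ β
  commuting-square⇒bijective f f' g β β-cong square = β-injective , β-surjective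
    where
    module f = Surjection f
    module f' = Bijection f'
    module g = Bijection g

    β-injective : Injective Y._≈_ Y'._≈_ β
    β-injective {y₁} {y₂} βy₁≈βy₂ =
      let (x₁ , fx₁≈y₁) = f.strictlySurjective y₁
          (x₂ , fx₂≈y₂) = f.strictlySurjective y₂
          f'gx₁≈f'gx₂ = begin
            f'.to (g.to x₁) ≈⟨ square x₁ ⟨
            β (f.to x₁)     ≈⟨ β-cong fx₁≈y₁ ⟩
            β y₁            ≈⟨ βy₁≈βy₂ ⟩
            β y₂            ≈⟨ β-cong fx₂≈y₂ ⟨
            β (f.to x₂)     ≈⟨ square x₂ ⟩
            f'.to (g.to x₂) ∎
      in Y.trans (Y.sym fx₁≈y₁)
           (Y.trans (f.cong (g.injective (f'.injective f'gx₁≈f'gx₂))) fx₂≈y₂)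
      where open SetoidReasoning Y'

    β-surjective : Surjective Y._≈_ Y'._≈_ β
    β-surjective y' =
      let (x' , f'x'≈y') = f'.strictlySurjective y'
          (x , gx≈x') = g.strictlySurjective x'
      in f.to x , λ z≈fx → Y'.trans (β-cong z≈fx)
                             (Y'.trans (square x) (Y'.trans (f'.cong gx≈x') f'x'≈y'))

module AutotopyConjugation
  {k : ℕ} {a b a₁ b₁ a' b' a₁' b₁' : Level}
  {S : Setoid a b} {X : Fin k → Setoid a₁ b₁}
  {π : ∀ i → Setoid.Carrier S → Setoid.Carrier (X i)}
  {S' : Setoid a' b'} {X' : Fin k → Setoid a₁' b₁'}
  {π' : ∀ i → Setoid.Carrier S' → Setoid.Carrier (X' i)}
  (π'-cong : ∀ i → Congruent (Setoid._≈_ S') (Setoid._≈_ (X' i)) (π' i))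
  (σ : Inverse S S') (σᵢ : ∀ i → Inverse (X i) (X' i))
  (commutes : ∀ i s → Setoid._≈_ (X' i) (π' i (Inverse.to σ s)) (Inverse.to (σᵢ i) (π i s)))
  where

  private
    module A = Autotopy S X π
    module A' = Autotopy S' X' π'
    module X i = Setoid (X i)
    module X' i = Setoid (X' i)
    module σ = Inverse σ
    module σᵢ i = Inverse (σᵢ i)
  open Inverse using (to; to-cong)

  -- σᵢ ∘ τ ∘ σᵢ⁻¹
  conjᵢ : ∀ i → Inverse (X i) (X i) → Inverse (X' i) (X' i)
  conjᵢ i τ = Composition.inverse (Composition.inverse (Symmetry.inverse (σᵢ i)) τ) (σᵢ i)

  conjᵢ-∘-σᵢ : ∀ i τ x → X'._≈_ i (to (conjᵢ i τ) (σᵢ.to i x)) (σᵢ.to i (to τ x))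
  conjᵢ-∘-σᵢ i τ x = σᵢ.to-cong i (to-cong τ (σᵢ.strictlyInverseʳ i x))

  π'-via-σ : ∀ i s' → X'._≈_ i (π' i s') (σᵢ.to i (π i (σ.from s')))
  π'-via-σ i s' =
    X'.trans i (π'-cong i (Setoid.sym S' (σ.strictlyInverseˡ s'))) (commutes i (σ.from s'))

  conjᵢ-π : ∀ i τ {s t} → X._≈_ i (to τ (π i s)) (π i t) →
            X'._≈_ i (to (conjᵢ i τ) (π' i (σ.to s))) (π' i (σ.to t))
  conjᵢ-π i τ {s} {t} τs≈t = begin
    to (conjᵢ i τ) (π' i (σ.to s))    ≈⟨ to-cong (conjᵢ i τ) (commutes i s) ⟩
    to (conjᵢ i τ) (σᵢ.to i (π i s))  ≈⟨ conjᵢ-∘-σᵢ i τ (π i s) ⟩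
    σᵢ.to i (to τ (π i s))            ≈⟨ σᵢ.to-cong i τs≈t ⟩
    σᵢ.to i (π i t)                   ≈⟨ commutes i t ⟨
    π' i (σ.to t)                     ∎
    where open SetoidReasoning (X' i)

  conj-preservesS : ∀ τ → A.PreservesS τ → A'.PreservesS (λ i → conjᵢ i (τ i))
  conj-preservesS τ (image⊆S , S⊆image) = image⊆S' , S'⊆image
    where
    image⊆S' : ∀ s' → ∃ λ t' → ∀ i → X'._≈_ i (to (conjᵢ i (τ i)) (π' i s')) (π' i t')
    image⊆S' s' =
      let (t , τs≈t) = image⊆S (σ.from s')
      in σ.to t , λ i →
           X'.trans i (to-cong (conjᵢ i (τ i)) (π'-cong i (Setoid.sym S' (σ.strictlyInverseˡ s'))))
                      (conjᵢ-π i (τ i) (τs≈t i))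
    S'⊆image : ∀ t' → ∃ λ s' → ∀ i → X'._≈_ i (to (conjᵢ i (τ i)) (π' i s')) (π' i t')
    S'⊆image t' =
      let (s , τs≈t) = S⊆image (σ.from t')
      in σ.to s , λ i →
           X'.trans i (conjᵢ-π i (τ i) (τs≈t i)) (π'-cong i (σ.strictlyInverseˡ t'))

  conj : Group.Carrier A.group → Group.Carrier A'.group
  conj (τ , preserves) = (λ i → conjᵢ i (τ i)) , conj-preservesS τ preserves

  conj-cong : Congruent A._≈A_ A'._≈A_ conj
  conj-cong τ≈ρ i y = σᵢ.to-cong i (τ≈ρ i (σᵢ.from i y))

  conj-injective : Injective A._≈A_ A'._≈A_ conj
  conj-injective {τ} {ρ} conjτ≈conjρ i x =
    Bijection.injective (Inverse⇒Bijection (σᵢ i)) (begin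
      σᵢ.to i (to (proj₁ τ i) x)                  ≈⟨ conjᵢ-∘-σᵢ i (proj₁ τ i) x ⟨
      to (conjᵢ i (proj₁ τ i)) (σᵢ.to i x)        ≈⟨ conjτ≈conjρ i (σᵢ.to i x) ⟩
      to (conjᵢ i (proj₁ ρ i)) (σᵢ.to i x)        ≈⟨ conjᵢ-∘-σᵢ i (proj₁ ρ i) x ⟩
      σᵢ.to i (to (proj₁ ρ i) x)                  ∎)
    where open SetoidReasoning (X' i)

  conj-isGroupHomomorphism :
    GroupMorphisms.IsGroupHomomorphism (Group.rawGroup A.group) (Group.rawGroup A'.group) conj
  conj-isGroupHomomorphism = record
    { isMonoidHomomorphism = record
      { isMagmaHomomorphism = record
        { isRelHomomorphism = record { cong = λ {τ} {ρ} → conj-cong {τ} {ρ} }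
        ; homo = λ τ ρ i y →
            σᵢ.to-cong i (to-cong (proj₁ τ i) (X.sym i (σᵢ.strictlyInverseʳ i _))) }
      ; ε-homo = λ i y → σᵢ.strictlyInverseˡ i y }
    ; ⁻¹-homo = λ τ i y → X'.refl i }

  conj-Stab : ∀ i {x x'} → X'._≈_ i (σᵢ.to i x) x' →
              ∀ {τ} → mem (A.Stab i x) τ → mem (A'.Stab i x') (conj τ)
  conj-Stab i {x} {x'} σx≈x' {τ} τx≈x = begin
    to (conjᵢ i (proj₁ τ i)) x'           ≈⟨ to-cong (conjᵢ i (proj₁ τ i)) σx≈x' ⟨
    to (conjᵢ i (proj₁ τ i)) (σᵢ.to i x)  ≈⟨ conjᵢ-∘-σᵢ i (proj₁ τ i) x ⟩
    σᵢ.to i (to (proj₁ τ i) x)            ≈⟨ σᵢ.to-cong i τx≈x ⟩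
    σᵢ.to i x                             ≈⟨ σx≈x' ⟩
    x'                                    ∎
    where open SetoidReasoning (X' i)

module _
  {k : ℕ} {a b a₁ b₁ a' b' a₁' b₁' : Level}
  {S : Setoid a b} {X : Fin k → Setoid a₁ b₁}
  {π : ∀ i → Setoid.Carrier S → Setoid.Carrier (X i)}
  {S' : Setoid a' b'} {X' : Fin k → Setoid a₁' b₁'}
  {π' : ∀ i → Setoid.Carrier S' → Setoid.Carrier (X' i)}
  (π-cong : ∀ i → Congruent (Setoid._≈_ S) (Setoid._≈_ (X i)) (π i))
  (π'-cong : ∀ i → Congruent (Setoid._≈_ S') (Setoid._≈_ (X' i)) (π' i))
  (σ : Inverse S S') (σᵢ : ∀ i → Inverse (X i) (X' i))
  (commutes : ∀ i s → Setoid._≈_ (X' i) (π' i (Inverse.to σ s)) (Inverse.to (σᵢ i) (π i s)))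
  where

  private
    module A = Autotopy S X π
    module A' = Autotopy S' X' π'
    module X i = Setoid (X i)
    module X' i = Setoid (X' i)
    module σᵢ i = Inverse (σᵢ i)
    module Forward = AutotopyConjugation π'-cong σ σᵢ commutes
    module Backward = AutotopyConjugation π-cong (Symmetry.inverse σ)
      (λ i → Symmetry.inverse (σᵢ i))
      (λ i s' → X.sym i (σᵢ.inverseʳ i (Forward.π'-via-σ i s')))
  open Inverse using (to; to-cong)

  conj-surjective : Surjective A._≈A_ A'._≈A_ Forward.conj
  conj-surjective τ' = Backward.conj τ' , λ {τ} τ≈ i y →
    X'.trans i (Forward.conj-cong {τ} {Backward.conj τ'} τ≈ i y)
      (X'.trans i (σᵢ.strictlyInverseˡ i _) (to-cong (proj₁ τ' i) (σᵢ.strictlyInverseˡ i y)))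

  conj-isGroupIsomorphism :
    GroupMorphisms.IsGroupIsomorphism (Group.rawGroup A.group) (Group.rawGroup A'.group) Forward.conj
  conj-isGroupIsomorphism = record
    { isGroupMonomorphism = record
      { isGroupHomomorphism = Forward.conj-isGroupHomomorphism
      ; injective = λ {τ} {ρ} → Forward.conj-injective {τ} {ρ} }
    ; surjective = conj-surjective }

module GroupPacketProperties {c ℓ p} {q n : ℕ} (G : Group c ℓ) (H : Fin (q + 2) → Subgroup G p)
  (K : Subgroup G p) (packet : IsGroupPacket q n G H K) where
  open Group G
  open GroupLemmas G using (cancelʳ)
  open CosetProperties
  open IsGroupPacket packet
  open Packet {q = q} G H K
  open Inverse using (to)

  i₀ i₁ : Fin (q + 2)
  i₀ = q ↑ʳ zero
  i₁ = q ↑ʳ suc zero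

  i₀≢i₁ : i₀ ≢ i₁
  i₀≢i₁ i₀≡i₁ with ↑ʳ-injective q zero (suc zero) i₀≡i₁
  ... | ()

  distinct-index : ∀ i → ∃ λ j → i ≢ j
  distinct-index i with i ≟ i₀
  ... | yes i≡i₀ = i₁ , λ i≡i₁ → i₀≢i₁ (≡.trans (≡.sym i≡i₀) i≡i₁)
  ... | no  i≢i₀ = i₀ , i≢i₀

  coset-K⇒H : ∀ i {x y} → CosetRel K x y → CosetRel (H i) x y
  coset-K⇒H i x~y =
    let (j , i≢j) = distinct-index i in proj₁ (proj₂ (intersection i j i≢j _) x~y)

  coset-H∩H⇒K : ∀ {i j} → i ≢ j → ∀ {x y} →
                CosetRel (H i) x y → CosetRel (H j) x y → CosetRel K x y
  coset-H∩H⇒K {i} {j} i≢j x~ᵢy x~ⱼy = proj₁ (intersection i j i≢j _) (x~ᵢy , x~ⱼy)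

  orthogonal : ∀ {i j} → i ≢ j → ∀ a b → ∃ λ x → CosetRel (H i) x a × CosetRel (H j) x b
  orthogonal {i} {j} i≢j a b =
    let ((h , h∈Hᵢ) , h~a⁻¹b) = inclusion-surjective (a ⁻¹ ∙ b)
    in a ∙ h ,
       coset-respʳ (H i) (identityʳ a) (coset-∙ˡ (H i) a (mem⇒coset-ε (H i) h∈Hᵢ)) ,
       coset-respʳ (H j) (cancelʳ a b) (coset-∙ˡ (H j) a (h~a⁻¹b {h , h∈Hᵢ} (coset-refl K)))
    where
    inclusion-surjective : Surjective (Setoid._≈_ (SubCoset (H i) K)) (CosetRel (H j)) proj₁
    inclusion-surjective =
      HasSize-injective⇒surjective (index-H-K i) (index-G-H j) proj₁ (coset-K⇒H j)
        (λ {x} {y} → coset-H∩H⇒K i≢j (∙∈ (H i) (⁻¹∈ (H i) (proj₂ x)) (proj₂ y)))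

  AutStabAll : Subgroup AutGroup p
  AutStabAll = record
    { mem = λ σ → ∀ i → mem (AutStab i) σ
    ; resp = λ {σ} {τ} σ≈τ σ∈ i → resp (AutStab i) {σ} {τ} σ≈τ (σ∈ i)
    ; ε∈ = λ i → ε∈ (AutStab i)
    ; ∙∈ = λ {σ} {τ} σ∈ τ∈ i → ∙∈ (AutStab i) {σ} {τ} (σ∈ i) (τ∈ i)
    ; ⁻¹∈ = λ {σ} σ∈ i → ⁻¹∈ (AutStab i) {σ} (σ∈ i) }

  -- σ maps the point K of G/K to some point tK; fixing two coordinates of it forces tK = K.
  AutStab-intersection : ∀ i j → i ≢ j → ∀ σ →
    (mem (AutStab i) σ × mem (AutStab j) σ → mem AutStabAll σ) ×
    (mem AutStabAll σ → mem (AutStab i) σ × mem (AutStab j) σ)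
  AutStab-intersection i j i≢j σ = fixes-all , λ σ∈ → σ∈ i , σ∈ j
    where
    fixes-all : mem (AutStab i) σ × mem (AutStab j) σ → mem AutStabAll σ
    fixes-all (σᵢε~ε , σⱼε~ε) k =
      let (t , σε~t) = proj₁ (proj₂ σ) ε
          ε~t = coset-H∩H⇒K i≢j (coset-trans (H i) (coset-sym (H i) σᵢε~ε) (σε~t i))
                                 (coset-trans (H j) (coset-sym (H j) σⱼε~ε) (σε~t j))
      in coset-trans (H k) (σε~t k) (coset-sym (H k) (coset-K⇒H k ε~t))

  leftMul-coset-cong : ∀ i → Congruent (CosetRel (H i)) (CosetRel (AutStab i)) leftMul
  leftMul-coset-cong i {g} {g'} g~g' =
    coset⇒translate-ε (H i) (coset-trans (H i) (≈⇒coset (H i) (identityʳ g')) (coset-sym (H i) g~g'))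

  leftMul-coset-injective : ∀ i → Injective (CosetRel (H i)) (CosetRel (AutStab i)) leftMul
  leftMul-coset-injective i {g} {g'} fg~fg' =
    coset-sym (H i) (coset-trans (H i) (≈⇒coset (H i) (sym (identityʳ g'))) (translate-ε⇒coset (H i) fg~fg'))

  leftMul-coset-surjective : ∀ i → Surjective (CosetRel (H i)) (CosetRel (AutStab i)) leftMul
  leftMul-coset-surjective i σ =
    to (proj₁ σ i) ε , λ g~σε → coset⇒translate-ε (H i) (coset-sym (H i) g~σε)

  leftMul-maps-into : ∀ i {h} → mem (H i) h → mem (AutStab i) (leftMul h)
  leftMul-maps-into i {h} h∈Hᵢ =
    coset-trans (H i) (≈⇒coset (H i) (identityʳ h)) (mem⇒coset-ε (H i) h∈Hᵢ)

  leftMul-bijection : ∀ i → Bijection (Coset (H i)) (Coset (AutStab i))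
  leftMul-bijection i = record
    { to = leftMul
    ; cong = leftMul-coset-cong i
    ; bijective = leftMul-coset-injective i , leftMul-coset-surjective i }

  leftMul-isGroupHomomorphism :
    GroupMorphisms.IsGroupHomomorphism (Group.rawGroup G) (Group.rawGroup AutGroup) leftMul
  leftMul-isGroupHomomorphism = record
    { isMonoidHomomorphism = record
      { isMagmaHomomorphism = record
        { isRelHomomorphism = record { cong = λ g≈h i x → ≈⇒coset (H i) (∙-congʳ g≈h) }
        ; homo = λ g h i x → ≈⇒coset (H i) (assoc g h x) }
      ; ε-homo = λ i x → ≈⇒coset (H i) (identityˡ x) }
    ; ⁻¹-homo = λ g i x → coset-refl (H i) }

  leftMul-isAdmissible : IsAdmissible G AutGroup H AutStab leftMul
  leftMul-isAdmissible = record
    { homomorphism = leftMul-isGroupHomomorphism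
    ; maps-into = leftMul-maps-into
    ; induced-bijective = λ i → leftMul-coset-injective i , leftMul-coset-surjective i }

  leftMul-restricted : ∀ i → Σ Carrier (mem (H i)) → Σ (Group.Carrier AutGroup) (mem (AutStab i))
  leftMul-restricted i (h , h∈Hᵢ) = leftMul h , leftMul-maps-into i h∈Hᵢ

  leftMul-subcoset-bijection : ∀ i → Bijection (SubCoset (H i) K) (SubCoset (AutStab i) AutStabAll)
  leftMul-subcoset-bijection i = record
    { to = leftMul-restricted i
    ; cong = λ h~h' k → leftMul-coset-cong k (coset-K⇒H k h~h')
    ; bijective = (λ {h} {h'} → injective {h} {h'}) , surjective }
    where
    open Setoid (SubCoset (H i) K) using () renaming (_≈_ to _~K_)
    open Setoid (SubCoset (AutStab i) AutStabAll) using () renaming (_≈_ to _~A_)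

    injective : Injective _~K_ _~A_ (leftMul-restricted i)
    injective fh~fh' = coset-H∩H⇒K i₀≢i₁ (leftMul-coset-injective i₀ (fh~fh' i₀))
                                         (leftMul-coset-injective i₁ (fh~fh' i₁))

    surjective : Surjective _~K_ _~A_ (leftMul-restricted i)
    surjective (σ , σᵢε~ε) =
      let (t , σε~t) = proj₁ (proj₂ σ) ε
      in (t , coset-ε⇒mem (H i) (coset-trans (H i) (coset-sym (H i) σᵢε~ε) (σε~t i))) ,
         λ z~t k → coset⇒translate-ε (H k)
                     (coset-trans (H k) (σε~t k) (coset-sym (H k) (coset-K⇒H k z~t)))

  autotopyPacket : IsGroupPacket q n AutGroup AutStab AutStabAll
  autotopyPacket = record
    { intersection = AutStab-intersection
    ; index-G-H = λ i → HasSize-resp-bijection (leftMul-bijection i) (index-G-H i)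
    ; index-H-K = λ i → HasSize-resp-bijection (leftMul-subcoset-bijection i) (index-H-K i) }

module AdmissibleMorphismProperties {c ℓ c' ℓ' p p'} {q n : ℕ}
  {G : Group c ℓ} {H : Fin (q + 2) → Subgroup G p} {K : Subgroup G p}
  {G' : Group c' ℓ'} {H' : Fin (q + 2) → Subgroup G' p'} {K' : Subgroup G' p'}
  (packet : IsGroupPacket q n G H K) (packet' : IsGroupPacket q n G' H' K')
  {α : Group.Carrier G → Group.Carrier G'} (admissible : IsAdmissible G G' H H' α) where

  private
    module P = GroupPacketProperties G H K packet
    module P' = GroupPacketProperties G' H' K' packet'
    module A = Packet G H K
    module A' = Packet G' H' K'
  open IsAdmissible admissible
  open GroupMorphisms.IsGroupHomomorphism homomorphism using (homo; ε-homo)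
  open CosetProperties using (coset-∙ˡ)

  α-coset-cong : ∀ i → Congruent (CosetRel (H i)) (CosetRel (H' i)) α
  α-coset-cong i = homomorphism⇒coset-cong homomorphism (H i) (H' i) (maps-into i)

  α-bijectionᵢ : ∀ i → Bijection (Coset (H i)) (Coset (H' i))
  α-bijectionᵢ i = record { to = α ; cong = α-coset-cong i ; bijective = induced-bijective i }

  α-K-cong : Congruent (CosetRel K) (CosetRel K') α
  α-K-cong x~y = P'.coset-H∩H⇒K P'.i₀≢i₁ (α-coset-cong P.i₀ (P.coset-K⇒H P.i₀ x~y))
                                         (α-coset-cong P.i₁ (P.coset-K⇒H P.i₁ x~y))

  α-K-injective : Injective (CosetRel K) (CosetRel K') α
  α-K-injective αx~αy =
    P.coset-H∩H⇒K P.i₀≢i₁ (proj₁ (induced-bijective P.i₀) (P'.coset-K⇒H P.i₀ αx~αy))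
                          (proj₁ (induced-bijective P.i₁) (P'.coset-K⇒H P.i₁ αx~αy))

  -- Preimages a, b of y' modulo H'_{i₀}, H'_{i₁} glue, by orthogonality, to one modulo K'.
  α-K-surjective : Surjective (CosetRel K) (CosetRel K') α
  α-K-surjective y' =
    let (a , αa~y') = Bijection.strictlySurjective (α-bijectionᵢ P.i₀) y'
        (b , αb~y') = Bijection.strictlySurjective (α-bijectionᵢ P.i₁) y'
        (x , x~a , x~b) = P.orthogonal P.i₀≢i₁ a b
    in x , λ z~x → coset-trans K' (α-K-cong z~x)
             (P'.coset-H∩H⇒K P'.i₀≢i₁ (coset-trans (H' P.i₀) (α-coset-cong P.i₀ x~a) αa~y')
                                       (coset-trans (H' P.i₁) (α-coset-cong P.i₁ x~b) αb~y'))

  α-bijection : Bijection (Coset K) (Coset K')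
  α-bijection = record { to = α ; cong = α-K-cong ; bijective = α-K-injective , α-K-surjective }

  isotopy : IsIsotopy (Coset K) (λ i → Coset (H i)) A.proj (Coset K') (λ i → Coset (H' i)) A'.proj
                      α (λ i → α)
  isotopy = record
    { σ-cong = α-K-cong
    ; σ-bijective = α-K-injective , α-K-surjective
    ; σᵢ-cong = α-coset-cong
    ; σᵢ-bijective = induced-bijective
    ; commutes = λ i s → coset-refl (H' i) }

  α-inverse : Inverse (Coset K) (Coset K')
  α-inverse = Bijection⇒Inverse α-bijection

  α-inverseᵢ : ∀ i → Inverse (Coset (H i)) (Coset (H' i))
  α-inverseᵢ i = Bijection⇒Inverse (α-bijectionᵢ i)

  open AutotopyConjugation P'.coset-K⇒H α-inverse α-inverseᵢ (λ i s → coset-refl (H' i)) public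
    using (conjᵢ-∘-σᵢ; conj-isGroupHomomorphism)
    renaming (conj to α*; conj-Stab to α*-Stab)

  α*-isGroupIsomorphism : GroupMorphisms.IsGroupIsomorphism (Group.rawGroup A.AutGroup)
                            (Group.rawGroup A'.AutGroup) α*
  α*-isGroupIsomorphism =
    conj-isGroupIsomorphism P.coset-K⇒H P'.coset-K⇒H α-inverse α-inverseᵢ (λ i s → coset-refl (H' i))

  α*-leftMul : ∀ g → Group._≈_ A'.AutGroup (α* (A.leftMul g)) (A'.leftMul (α g))
  α*-leftMul g i y =
    coset-trans (H' i) (≈⇒coset (H' i) (homo g _))
      (coset-∙ˡ (H' i) (α g) (Inverse.strictlyInverseˡ (α-inverseᵢ i) y))

  α*-maps-into : ∀ i {σ} → mem (A.AutStab i) σ → mem (A'.AutStab i) (α* σ)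
  α*-maps-into i {σ} = α*-Stab i (≈⇒coset (H' i) ε-homo) {σ}

  α*-coset-cong : ∀ i → Congruent (CosetRel (A.AutStab i)) (CosetRel (A'.AutStab i)) α*
  α*-coset-cong i {σ} {τ} = homomorphism⇒coset-cong conj-isGroupHomomorphism
    (A.AutStab i) (A'.AutStab i) (λ {ρ} → α*-maps-into i {ρ}) {σ} {τ}

  α*-isAdmissible : IsAdmissible A.AutGroup A'.AutGroup A.AutStab A'.AutStab α*
  α*-isAdmissible = record
    { homomorphism = conj-isGroupHomomorphism
    ; maps-into = α*-maps-into
    ; induced-bijective = λ i →
        commuting-square⇒bijective (Bijection.surjection (P.leftMul-bijection i))
          (P'.leftMul-bijection i) (α-bijectionᵢ i) α*
          (λ {σ} {τ} → α*-coset-cong i {σ} {τ})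
          (λ g → ≈⇒coset (A'.AutStab i) {α* (A.leftMul g)} {A'.leftMul (α g)} (α*-leftMul g)) }

lemma3p15 : ∀ {c ℓ c' ℓ' p p' : Level} (q n : ℕ)
  (G : Group c ℓ) (H : Fin (q + 2) → Subgroup G p) (K : Subgroup G p)
  (G' : Group c' ℓ') (H' : Fin (q + 2) → Subgroup G' p') (K' : Subgroup G' p')
  → IsGroupPacket q n G H K
  → IsGroupPacket q n G' H' K'
  → (α : Group.Carrier G → Group.Carrier G')
  → IsAdmissible G G' H H' α
  → let A = Packet.AutGroup G H K
        A' = Packet.AutGroup G' H' K'
        Aᵢ = Packet.AutStab G H K
        A'ᵢ = Packet.AutStab G' H' K'
        f = Packet.leftMul G H K
        f' = Packet.leftMul G' H' K'
    in IsIsotopy (Coset K) (λ i → Coset (H i)) (Packet.proj G H K)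
                 (Coset K') (λ i → Coset (H' i)) (Packet.proj G' H' K')
                 α (λ i → α)
       × Σ (Group.Carrier A → Group.Carrier A') (λ α* →
           (∀ σ i x → CosetRel (H' i) (Inverse.to (proj₁ (α* σ) i) (α x))
                                      (α (Inverse.to (proj₁ σ i) x)))
           × GroupMorphisms.IsGroupIsomorphism (Group.rawGroup A) (Group.rawGroup A') α*
           × (∀ g → Group._≈_ A' (α* (f g)) (f' (α g)))
           × Σ (Subgroup A p) (IsGroupPacket q n A Aᵢ)
           × Σ (Subgroup A' p') (IsGroupPacket q n A' A'ᵢ)
           × IsAdmissible G A H Aᵢ f
           × IsAdmissible G' A' H' A'ᵢ f'
           × IsAdmissible A A' Aᵢ A'ᵢ α*)
lemma3p15 q n G H K G' H' K' packet packet' α admissible =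
  isotopy , α* , (λ σ i → conjᵢ-∘-σᵢ i (proj₁ σ i)) , α*-isGroupIsomorphism , α*-leftMul ,
  (P.AutStabAll , P.autotopyPacket) , (P'.AutStabAll , P'.autotopyPacket) ,
  P.leftMul-isAdmissible , P'.leftMul-isAdmissible , α*-isAdmissible
  where
  module P = GroupPacketProperties G H K packet
  module P' = GroupPacketProperties G' H' K' packet'
  open AdmissibleMorphismProperties packet packet' admissible
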